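{- Let $k\ge1$ and let $u,v\in A^*$ be words of length at least $k-1$ such that $|u|_t=|v|_t$ for every word $t$ of length $k$. Then the following are equivalent: (1) $|u|_s=|v|_s$ for all non-empty words $s$ with $|s|\le k-1$; (2) $|u|_s=|v|_s$ for all $s\in A^{k-1}$; (3) $\mathrm{pref}_{k-1}(u)=\mathrm{pref}_{k-1}(v)$ and $\mathrm{suff}_{k-1}(u)=\mathrm{suff}_{k-1}(v)$; (4) $\mathrm{pref}_{k-1}(u)=\mathrm{pref}_{k-1}(v)$; (5) $\mathrm{suff}_{k-1}(u)=\mathrm{suff}_{k-1}(v)$; (6) $\mathrm{pref}_i(u)=\mathrm{pref}_i(v)$ and $\mathrm{suff}_{k-1-i}(u)=\mathrm{suff}_{k-1-i}(v)$ for some $i\in\{0,\dots,k-1\}$.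
   Context: $|u|_x$ is the number of occurrences of the word $x$ as a factor of $u$. $\mathrm{pref}_j(u)$ and $\mathrm{suff}_j(u)$ denote the prefix and the suffix of $u$ of length $j$. -}

module Defs where

open import Data.Nat using (ℕ; zero; suc; _+_; _∸_)
open import Data.List using (List; []; _∷_; length; take; drop)
open import Data.Bool using (Bool; true; false; _∧_)
open import Relation.Nullary using (does)
open import Relation.Binary.Definitions using (DecidableEquality)

b2n : Bool → ℕ
b2n true = 1
b2n false = 0

module Words {A : Set} (_≟_ : DecidableEquality A) where

  isPrefix : List A → List A → Bool
  isPrefix [] _ = true
  isPrefix (a ∷ x) [] = false
  isPrefix (a ∷ x) (b ∷ u) = does (a ≟ b) ∧ isPrefix x u

  -- |u|_x : number of positions of u at which x occurs as a factor
  -- (for x = [] this counts length u + 1, i.e. the occurrences of the empty word)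
  occ : List A → List A → ℕ
  occ x [] = b2n (isPrefix x [])
  occ x (b ∷ u) = b2n (isPrefix x (b ∷ u)) + occ x u

  pref : ℕ → List A → List A
  pref j u = take j u

  suff : ℕ → List A → List A
  suff j u = drop (length u ∸ j) u

-- Fix an alphabet list L containing every letter of u and v. Extending a factor s
-- to the right by one letter gives |u|_s = Σ_a |u|_{sa} + [s is a suffix of u], and extending
-- to the left gives |u|_s = Σ_a |u|_{as} + [s is a prefix of u]. When all counts of length m+1
-- agree, these identities turn agreement of the counts of length m into agreement of suff_m
-- (resp. pref_m), so (2), (4), (5) are equivalent, and downward induction on the length gives
-- (1). Subtracting the two identities gives the balance
-- [s = suff_m u] + [s = pref_m v] = [s = suff_m v] + [s = pref_m u]; if pref_m u ≠ pref_m v,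
-- taking s = pref_m u and s = pref_m v shows that pref_m u = suff_m u and pref_m v = suff_m v,
-- and each of these words is then glued together from pref_i and suff_{m-i}, so (6) forces
-- pref_m u = pref_m v.
module Submission where

open import Defs
open import Data.Nat using (ℕ; _≤_; _∸_; _+_; suc)
open import Data.List using (List; length; [])
open import Data.Product using (_×_; Σ)
open import Relation.Binary.PropositionalEquality using (_≡_; _≢_)
open import Relation.Binary.Definitions using (DecidableEquality)
open import Function.Bundles using (_⇔_)

open import Algebra.Properties.CommutativeSemigroup using (interchange)
open import Data.Bool using (true; _∧_)
open import Data.Empty using (⊥-elim)
open import Data.List using (_∷_; _++_; [_]; map; take; drop; deduplicate)
open import Data.List.Membership.Propositional using (_∈_)
open import Data.List.Membership.Propositional.Properties using (∈-++⁺ˡ; ∈-++⁺ʳ; ∈-deduplicate⁺)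
open import Data.List.Properties
  using (≡-dec; map-cong; length-take; length-drop; take-take; drop-drop; drop-all; take++drop≡id; length-++)
open import Data.List.Relation.Unary.All using (All; []; _∷_; tabulate)
open import Data.List.Relation.Unary.Any using (here; there)
open import Data.List.Relation.Unary.Unique.Propositional using (Unique; _∷_)
open import Data.List.Relation.Unary.Unique.DecPropositional.Properties using (deduplicate-!)
open import Data.Nat using (zero; _<_; s≤s)
open import Data.Nat.ListAction using (sum)
open import Data.Nat.Properties
open import Data.Product using (_,_; proj₁)
open import Function.Bundles using (mk⇔; Equivalence)
open import Relation.Nullary using (does; yes; no)
open import Relation.Nullary.Decidable using (dec-true; dec-false)
open import Relation.Binary.PropositionalEquality using (refl; sym; trans; cong; cong₂; subst; module ≡-Reasoning)
open import Data.Nat.Tactic.RingSolver using (solve-∀)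

+-cross-cancel : ∀ a b c d e f → a + c ≡ b + d → a + e ≡ b + f → c + f ≡ e + d
+-cross-cancel a b c d e f p q = +-cancelʳ-≡ (a + b) (c + f) (e + d) (begin
  (c + f) + (a + b)   ≡⟨ regroupˡ a b c f ⟩
  (a + c) + (b + f)   ≡⟨ cong₂ _+_ p (sym q) ⟩
  (b + d) + (a + e)   ≡⟨ regroupʳ a b d e ⟩
  (e + d) + (a + b)   ∎)
  where
  open ≡-Reasoning
  regroupˡ : ∀ a b c f → (c + f) + (a + b) ≡ (a + c) + (b + f)
  regroupˡ = solve-∀
  regroupʳ : ∀ a b d e → (b + d) + (a + e) ≡ (e + d) + (a + b)
  regroupʳ = solve-∀

∑ : {A : Set} → List A → (A → ℕ) → ℕ
∑ L f = sum (map f L)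

module _ {A : Set} where

  ∑-cong : ∀ (L : List A) {f g : A → ℕ} → (∀ a → f a ≡ g a) → ∑ L f ≡ ∑ L g
  ∑-cong L f≗g = cong sum (map-cong f≗g L)

  ∑-+ : ∀ (L : List A) (f g : A → ℕ) → ∑ L (λ a → f a + g a) ≡ ∑ L f + ∑ L g
  ∑-+ [] f g = refl
  ∑-+ (a ∷ L) f g = trans (cong (f a + g a +_) (∑-+ L f g))
                          (interchange +-commutativeSemigroup (f a) (g a) (∑ L f) (∑ L g))

  ∑-zero : ∀ (L : List A) → ∑ L (λ _ → 0) ≡ 0
  ∑-zero [] = refl
  ∑-zero (a ∷ L) = ∑-zero L

module _ {A : Set} (_≟_ : DecidableEquality A) where
  open Words _≟_

  _≟ₗ_ : DecidableEquality (List A)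
  _≟ₗ_ = ≡-dec _≟_

  ∑-select-∉ : ∀ L b y → All (b ≢_) L → ∑ L (λ a → b2n (does (a ≟ b) ∧ y)) ≡ 0
  ∑-select-∉ [] b y _ = refl
  ∑-select-∉ (c ∷ L) b y (b≢c ∷ b∉L) with c ≟ b
  ... | yes c≡b = ⊥-elim (b≢c (sym c≡b))
  ... | no _ = ∑-select-∉ L b y b∉L

  ∑-select : ∀ L b y → Unique L → b ∈ L → ∑ L (λ a → b2n (does (a ≟ b) ∧ y)) ≡ b2n y
  ∑-select (c ∷ L) b y (c∉L ∷ _) _ with c ≟ b
  ∑-select (c ∷ L) b y (c∉L ∷ _) _          | yes refl = trans (cong (b2n y +_) (∑-select-∉ L b y c∉L)) (+-identityʳ _)
  ∑-select (c ∷ L) b y _         (here b≡c)  | no c≢b   = ⊥-elim (c≢b (sym b≡c))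
  ∑-select (c ∷ L) b y (_ ∷ L!)  (there b∈L) | no _     = ∑-select L b y L! b∈L

  δ : List A → List A → ℕ
  δ s w = b2n (does (s ≟ₗ w))

  δ-refl : ∀ s → δ s s ≡ 1
  δ-refl s = cong b2n (dec-true (s ≟ₗ s) refl)

  δ-≢ : ∀ s w → s ≢ w → δ s w ≡ 0
  δ-≢ s w s≢w = cong b2n (dec-false (s ≟ₗ w) s≢w)

  δ-positive⇒≡ : ∀ s w {k} → δ s w ≡ suc k → s ≡ w
  δ-positive⇒≡ s w δ>0 with s ≟ₗ w
  ... | yes s≡w = s≡w
  ... | no _ with () ← δ>0

  occSuffix : List A → List A → ℕ
  occSuffix s [] = δ s []
  occSuffix s (b ∷ u) = δ s (b ∷ u) + occSuffix s u

  module _ (L : List A) (L! : Unique L) where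

    isPrefix-extendʳ : ∀ s w → All (_∈ L) w →
      b2n (isPrefix s w) ≡ ∑ L (λ a → b2n (isPrefix (s ++ [ a ]) w)) + δ s w
    isPrefix-extendʳ [] [] _ = sym (cong (_+ 1) (∑-zero L))
    isPrefix-extendʳ [] (b ∷ w) (b∈L ∷ _) = sym (trans (+-identityʳ _) (∑-select L b true L! b∈L))
    isPrefix-extendʳ (c ∷ s) [] _ = sym (trans (+-identityʳ _) (∑-zero L))
    isPrefix-extendʳ (c ∷ s) (b ∷ w) (_ ∷ w⊆L) with c ≟ b
    ... | yes _ = isPrefix-extendʳ s w w⊆L
    ... | no _ = sym (trans (+-identityʳ _) (∑-zero L))

    occ-extendʳ : ∀ s u → All (_∈ L) u → occ s u ≡ ∑ L (λ a → occ (s ++ [ a ]) u) + occSuffix s u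
    occ-extendʳ s [] _ = isPrefix-extendʳ s [] []
    occ-extendʳ s (b ∷ u) bu⊆L@(_ ∷ u⊆L) = begin
      b2n (isPrefix s (b ∷ u)) + occ s u
        ≡⟨ cong₂ _+_ (isPrefix-extendʳ s (b ∷ u) bu⊆L) (occ-extendʳ s u u⊆L) ⟩
      (∑ L extAtHead + exact) + (∑ L extInTail + occSuffix s u)
        ≡⟨ interchange +-commutativeSemigroup (∑ L extAtHead) exact (∑ L extInTail) (occSuffix s u) ⟩
      (∑ L extAtHead + ∑ L extInTail) + (exact + occSuffix s u)
        ≡⟨ cong (_+ (exact + occSuffix s u)) (∑-+ L extAtHead extInTail) ⟨
      ∑ L (λ a → extAtHead a + extInTail a) + (exact + occSuffix s u) ∎
      where
      open ≡-Reasoning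
      extAtHead extInTail : A → ℕ
      extAtHead a = b2n (isPrefix (s ++ [ a ]) (b ∷ u))
      extInTail a = occ (s ++ [ a ]) u
      exact : ℕ
      exact = δ s (b ∷ u)

    occ-extendˡ : ∀ s u → All (_∈ L) u → occ s u ≡ ∑ L (λ a → occ (a ∷ s) u) + b2n (isPrefix s u)
    occ-extendˡ s [] _ = cong (_+ b2n (isPrefix s [])) (sym (∑-zero L))
    occ-extendˡ s (b ∷ u) (b∈L ∷ u⊆L) = begin
      atHead + occ s u
        ≡⟨ cong (atHead +_) (occ-extendˡ s u u⊆L) ⟩
      atHead + (∑ L extInTail + b2n (isPrefix s u))
        ≡⟨ +-comm atHead _ ⟩
      (∑ L extInTail + b2n (isPrefix s u)) + atHead
        ≡⟨ cong (_+ atHead) (+-comm (∑ L extInTail) _) ⟩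
      (b2n (isPrefix s u) + ∑ L extInTail) + atHead
        ≡⟨ cong (λ x → (x + ∑ L extInTail) + atHead) (∑-select L b (isPrefix s u) L! b∈L) ⟨
      (∑ L extAtHead + ∑ L extInTail) + atHead
        ≡⟨ cong (_+ atHead) (∑-+ L extAtHead extInTail) ⟨
      ∑ L (λ a → extAtHead a + extInTail a) + atHead ∎
      where
      open ≡-Reasoning
      atHead : ℕ
      atHead = b2n (isPrefix s (b ∷ u))
      extAtHead extInTail : A → ℕ
      extAtHead a = b2n (does (a ≟ b) ∧ isPrefix s u)
      extInTail a = occ (a ∷ s) u

  length-pref : ∀ n u → n ≤ length u → length (pref n u) ≡ n
  length-pref n u n≤∣u∣ = trans (length-take n u) (m≤n⇒m⊓n≡m n≤∣u∣)

  length-suff : ∀ n u → n ≤ length u → length (suff n u) ≡ n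
  length-suff n u n≤∣u∣ = trans (length-drop (length u ∸ n) u) (m∸[m∸n]≡n n≤∣u∣)

  suff-suff : ∀ m n u → m ≤ n → n ≤ length u → suff m (suff n u) ≡ suff m u
  suff-suff m n u m≤n n≤∣u∣ rewrite length-suff n u n≤∣u∣ = begin
    drop (n ∸ m) (drop (length u ∸ n) u)   ≡⟨ drop-drop (length u ∸ n) (n ∸ m) u ⟩
    drop (length u ∸ n + (n ∸ m)) u        ≡⟨ cong (λ j → drop j u) offset ⟩
    drop (length u ∸ m) u                  ∎
    where
    open ≡-Reasoning
    offset : length u ∸ n + (n ∸ m) ≡ length u ∸ m
    offset = trans (sym (+-∸-assoc (length u ∸ n) m≤n)) (cong (_∸ m) (m∸n+n≡m n≤∣u∣))

  pref-pref : ∀ i n u → i ≤ n → pref i (pref n u) ≡ pref i u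
  pref-pref i n u i≤n = trans (take-take i n u) (cong (λ j → take j u) (m≤n⇒m⊓n≡m i≤n))

  pref-border-split : ∀ i n u → i ≤ n → n ≤ length u → pref n u ≡ suff n u →
                      pref n u ≡ pref i u ++ suff (n ∸ i) u
  pref-border-split i n u i≤n n≤∣u∣ border = begin
    pref n u                                    ≡⟨ take++drop≡id i (pref n u) ⟨
    pref i (pref n u) ++ drop i (pref n u)      ≡⟨ cong₂ _++_ (pref-pref i n u i≤n) (cong (drop i) border) ⟩
    pref i u ++ drop i (suff n u)               ≡⟨ cong (pref i u ++_) dropᵢ≡suff ⟩
    pref i u ++ suff (n ∸ i) u                  ∎
    where
    open ≡-Reasoning
    dropᵢ≡suff : drop i (suff n u) ≡ suff (n ∸ i) u
    dropᵢ≡suff = begin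
      drop i (suff n u)                                 ≡⟨ cong (λ j → drop j (suff n u)) (m∸[m∸n]≡n i≤n) ⟨
      drop (n ∸ (n ∸ i)) (suff n u)                     ≡⟨ cong (λ j → drop (j ∸ (n ∸ i)) (suff n u)) (length-suff n u n≤∣u∣) ⟨
      suff (n ∸ i) (suff n u)                           ≡⟨ suff-suff (n ∸ i) n u (m∸n≤m n i) n≤∣u∣ ⟩
      suff (n ∸ i) u                                    ∎

  isPrefix-pref : ∀ s u → length s ≤ length u → isPrefix s u ≡ does (s ≟ₗ pref (length s) u)
  isPrefix-pref [] u _ = refl
  isPrefix-pref (c ∷ s) (b ∷ u) (s≤s ∣s∣≤∣u∣) = cong (does (c ≟ b) ∧_) (isPrefix-pref s u ∣s∣≤∣u∣)

  occSuffix-short : ∀ s u → length u < length s → occSuffix s u ≡ 0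
  occSuffix-short (c ∷ s) [] _ = refl
  occSuffix-short s (b ∷ u) ∣bu∣<∣s∣ =
    cong₂ _+_ (δ-≢ s (b ∷ u) (λ s≡bu → <-irrefl (cong length (sym s≡bu)) ∣bu∣<∣s∣))
              (occSuffix-short s u (<-trans (n<1+n _) ∣bu∣<∣s∣))

  occSuffix-suff : ∀ s u → length s ≤ length u → occSuffix s u ≡ δ s (suff (length s) u)
  occSuffix-suff [] [] _ = refl
  occSuffix-suff s (b ∷ u) ∣s∣≤∣bu∣ with length s ≤? length u
  ... | yes ∣s∣≤∣u∣ rewrite +-∸-assoc 1 ∣s∣≤∣u∣ =
    trans (cong (_+ occSuffix s u) (δ-≢ s (b ∷ u) (λ s≡bu → <-irrefl (cong length s≡bu) (s≤s ∣s∣≤∣u∣))))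
          (occSuffix-suff s u ∣s∣≤∣u∣)
  ... | no ∣s∣≰∣u∣ rewrite occSuffix-short s u (≰⇒> ∣s∣≰∣u∣) | ≤-antisym ∣s∣≤∣bu∣ (≰⇒> ∣s∣≰∣u∣) | n∸n≡0 (length u) =
    +-identityʳ _

  OccAgree : ℕ → List A → List A → Set
  OccAgree m u v = ∀ s → length s ≡ m → occ s u ≡ occ s v

  module SameLongerFactors (m : ℕ) (u v : List A) (∣u∣≥m : m ≤ length u) (∣v∣≥m : m ≤ length v)
                           (agree : OccAgree (suc m) u v) where

    private
      L : List A
      L = deduplicate _≟_ (u ++ v)

      L! : Unique L
      L! = deduplicate-! _≟_ (u ++ v)

      u⊆L : All (_∈ L) u
      u⊆L = tabulate (λ a∈u → ∈-deduplicate⁺ _≟_ (∈-++⁺ˡ a∈u))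

      v⊆L : All (_∈ L) v
      v⊆L = tabulate (λ a∈v → ∈-deduplicate⁺ _≟_ (∈-++⁺ʳ u a∈v))

      ∑ʳ ∑ˡ : List A → List A → ℕ
      ∑ʳ s w = ∑ L (λ a → occ (s ++ [ a ]) w)
      ∑ˡ s w = ∑ L (λ a → occ (a ∷ s) w)

      ∑ʳ-agree : ∀ s → length s ≡ m → ∑ʳ s u ≡ ∑ʳ s v
      ∑ʳ-agree s refl = ∑-cong L (λ a → agree (s ++ [ a ]) (trans (length-++ s) (+-comm (length s) 1)))

      ∑ˡ-agree : ∀ s → length s ≡ m → ∑ˡ s u ≡ ∑ˡ s v
      ∑ˡ-agree s refl = ∑-cong L (λ a → agree (a ∷ s) refl)

      occSuffix-at : ∀ s w → length s ≡ m → m ≤ length w → occSuffix s w ≡ δ s (suff m w)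
      occSuffix-at s w refl = occSuffix-suff s w

      isPrefix-at : ∀ s w → length s ≡ m → m ≤ length w → b2n (isPrefix s w) ≡ δ s (pref m w)
      isPrefix-at s w refl ∣s∣≤∣w∣ = cong b2n (isPrefix-pref s w ∣s∣≤∣w∣)

    occ≡⇔suff-δ≡ : ∀ s → length s ≡ m → (occ s u ≡ occ s v) ⇔ (δ s (suff m u) ≡ δ s (suff m v))
    occ≡⇔suff-δ≡ s ∣s∣≡m = mk⇔ to from
      where
      open ≡-Reasoning
      to : occ s u ≡ occ s v → δ s (suff m u) ≡ δ s (suff m v)
      to occ≡ = +-cancelˡ-≡ (∑ʳ s u) _ _ (begin
        ∑ʳ s u + δ s (suff m u)      ≡⟨ cong (∑ʳ s u +_) (occSuffix-at s u ∣s∣≡m ∣u∣≥m) ⟨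
        ∑ʳ s u + occSuffix s u       ≡⟨ occ-extendʳ L L! s u u⊆L ⟨
        occ s u                      ≡⟨ occ≡ ⟩
        occ s v                      ≡⟨ occ-extendʳ L L! s v v⊆L ⟩
        ∑ʳ s v + occSuffix s v       ≡⟨ cong₂ _+_ (sym (∑ʳ-agree s ∣s∣≡m)) (occSuffix-at s v ∣s∣≡m ∣v∣≥m) ⟩
        ∑ʳ s u + δ s (suff m v)      ∎)
      from : δ s (suff m u) ≡ δ s (suff m v) → occ s u ≡ occ s v
      from δ≡ = begin
        occ s u                      ≡⟨ occ-extendʳ L L! s u u⊆L ⟩
        ∑ʳ s u + occSuffix s u       ≡⟨ cong (∑ʳ s u +_) (occSuffix-at s u ∣s∣≡m ∣u∣≥m) ⟩
        ∑ʳ s u + δ s (suff m u)      ≡⟨ cong₂ _+_ (∑ʳ-agree s ∣s∣≡m) δ≡ ⟩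
        ∑ʳ s v + δ s (suff m v)      ≡⟨ cong (∑ʳ s v +_) (occSuffix-at s v ∣s∣≡m ∣v∣≥m) ⟨
        ∑ʳ s v + occSuffix s v       ≡⟨ occ-extendʳ L L! s v v⊆L ⟨
        occ s v                      ∎

    occ≡⇔pref-δ≡ : ∀ s → length s ≡ m → (occ s u ≡ occ s v) ⇔ (δ s (pref m u) ≡ δ s (pref m v))
    occ≡⇔pref-δ≡ s ∣s∣≡m = mk⇔ to from
      where
      open ≡-Reasoning
      to : occ s u ≡ occ s v → δ s (pref m u) ≡ δ s (pref m v)
      to occ≡ = +-cancelˡ-≡ (∑ˡ s u) _ _ (begin
        ∑ˡ s u + δ s (pref m u)          ≡⟨ cong (∑ˡ s u +_) (isPrefix-at s u ∣s∣≡m ∣u∣≥m) ⟨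
        ∑ˡ s u + b2n (isPrefix s u)      ≡⟨ occ-extendˡ L L! s u u⊆L ⟨
        occ s u                          ≡⟨ occ≡ ⟩
        occ s v                          ≡⟨ occ-extendˡ L L! s v v⊆L ⟩
        ∑ˡ s v + b2n (isPrefix s v)      ≡⟨ cong₂ _+_ (sym (∑ˡ-agree s ∣s∣≡m)) (isPrefix-at s v ∣s∣≡m ∣v∣≥m) ⟩
        ∑ˡ s u + δ s (pref m v)          ∎)
      from : δ s (pref m u) ≡ δ s (pref m v) → occ s u ≡ occ s v
      from δ≡ = begin
        occ s u                          ≡⟨ occ-extendˡ L L! s u u⊆L ⟩
        ∑ˡ s u + b2n (isPrefix s u)      ≡⟨ cong (∑ˡ s u +_) (isPrefix-at s u ∣s∣≡m ∣u∣≥m) ⟩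
        ∑ˡ s u + δ s (pref m u)          ≡⟨ cong₂ _+_ (∑ˡ-agree s ∣s∣≡m) δ≡ ⟩
        ∑ˡ s v + δ s (pref m v)          ≡⟨ cong (∑ˡ s v +_) (isPrefix-at s v ∣s∣≡m ∣v∣≥m) ⟨
        ∑ˡ s v + b2n (isPrefix s v)      ≡⟨ occ-extendˡ L L! s v v⊆L ⟨
        occ s v                          ∎

    occ-agree⇔suff≡ : OccAgree m u v ⇔ (suff m u ≡ suff m v)
    occ-agree⇔suff≡ = mk⇔ to from
      where
      U = suff m u
      ∣U∣≡m = length-suff m u ∣u∣≥m
      to : OccAgree m u v → U ≡ suff m v
      to agreeₘ = δ-positive⇒≡ U (suff m v)
        (trans (sym (Equivalence.to (occ≡⇔suff-δ≡ U ∣U∣≡m) (agreeₘ U ∣U∣≡m))) (δ-refl U))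
      from : U ≡ suff m v → OccAgree m u v
      from U≡V s ∣s∣≡m = Equivalence.from (occ≡⇔suff-δ≡ s ∣s∣≡m) (cong (δ s) U≡V)

    occ-agree⇔pref≡ : OccAgree m u v ⇔ (pref m u ≡ pref m v)
    occ-agree⇔pref≡ = mk⇔ to from
      where
      X = pref m u
      ∣X∣≡m = length-pref m u ∣u∣≥m
      to : OccAgree m u v → X ≡ pref m v
      to agreeₘ = δ-positive⇒≡ X (pref m v)
        (trans (sym (Equivalence.to (occ≡⇔pref-δ≡ X ∣X∣≡m) (agreeₘ X ∣X∣≡m))) (δ-refl X))
      from : X ≡ pref m v → OccAgree m u v
      from X≡Y s ∣s∣≡m = Equivalence.from (occ≡⇔pref-δ≡ s ∣s∣≡m) (cong (δ s) X≡Y)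

    border-balance : ∀ s → length s ≡ m →
                     δ s (suff m u) + δ s (pref m v) ≡ δ s (suff m v) + δ s (pref m u)
    border-balance s ∣s∣≡m = begin
      δ s (suff m u) + δ s (pref m v)      ≡⟨ cong₂ _+_ (occSuffix-at s u ∣s∣≡m ∣u∣≥m) (isPrefix-at s v ∣s∣≡m ∣v∣≥m) ⟨
      occSuffix s u + b2n (isPrefix s v)   ≡⟨ +-cross-cancel (∑ʳ s u) (∑ˡ s u) _ _ _ _ two-ways-u two-ways-v ⟩
      occSuffix s v + b2n (isPrefix s u)   ≡⟨ cong₂ _+_ (occSuffix-at s v ∣s∣≡m ∣v∣≥m) (isPrefix-at s u ∣s∣≡m ∣u∣≥m) ⟩
      δ s (suff m v) + δ s (pref m u)      ∎
      where
      open ≡-Reasoning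
      two-ways-u : ∑ʳ s u + occSuffix s u ≡ ∑ˡ s u + b2n (isPrefix s u)
      two-ways-u = trans (sym (occ-extendʳ L L! s u u⊆L)) (occ-extendˡ L L! s u u⊆L)
      two-ways-v : ∑ʳ s u + occSuffix s v ≡ ∑ˡ s u + b2n (isPrefix s v)
      two-ways-v = begin
        ∑ʳ s u + occSuffix s v         ≡⟨ cong (_+ occSuffix s v) (∑ʳ-agree s ∣s∣≡m) ⟩
        ∑ʳ s v + occSuffix s v         ≡⟨ occ-extendʳ L L! s v v⊆L ⟨
        occ s v                        ≡⟨ occ-extendˡ L L! s v v⊆L ⟩
        ∑ˡ s v + b2n (isPrefix s v)    ≡⟨ cong (_+ b2n (isPrefix s v)) (∑ˡ-agree s ∣s∣≡m) ⟨
        ∑ˡ s u + b2n (isPrefix s v)    ∎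

    pref≡suff-if-pref≢ : pref m u ≢ pref m v → pref m u ≡ suff m u
    pref≡suff-if-pref≢ X≢Y = δ-positive⇒≡ X (suff m u) (begin
      δ X (suff m u)                   ≡⟨ +-identityʳ _ ⟨
      δ X (suff m u) + 0               ≡⟨ cong (δ X (suff m u) +_) (δ-≢ X (pref m v) X≢Y) ⟨
      δ X (suff m u) + δ X (pref m v)  ≡⟨ border-balance X (length-pref m u ∣u∣≥m) ⟩
      δ X (suff m v) + δ X X           ≡⟨ cong (δ X (suff m v) +_) (δ-refl X) ⟩
      δ X (suff m v) + 1               ≡⟨ +-comm _ 1 ⟩
      suc (δ X (suff m v))             ∎)
      where
      open ≡-Reasoning
      X = pref m u

  pref≡-from-split : ∀ m u v (∣u∣≥m : m ≤ length u) (∣v∣≥m : m ≤ length v) → OccAgree (suc m) u v →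
                     ∀ i → i ≤ m → pref i u ≡ pref i v → suff (m ∸ i) u ≡ suff (m ∸ i) v →
                     pref m u ≡ pref m v
  pref≡-from-split m u v ∣u∣≥m ∣v∣≥m agree i i≤m prefᵢ≡ suffₘ₋ᵢ≡ with pref m u ≟ₗ pref m v
  ... | yes X≡Y = X≡Y
  ... | no X≢Y = ⊥-elim (X≢Y (begin
    pref m u                        ≡⟨ pref-border-split i m u i≤m ∣u∣≥m X-border ⟩
    pref i u ++ suff (m ∸ i) u      ≡⟨ cong₂ _++_ prefᵢ≡ suffₘ₋ᵢ≡ ⟩
    pref i v ++ suff (m ∸ i) v      ≡⟨ pref-border-split i m v i≤m ∣v∣≥m Y-border ⟨
    pref m v                        ∎))
    where
    open ≡-Reasoning
    X-border : pref m u ≡ suff m u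
    X-border = SameLongerFactors.pref≡suff-if-pref≢ m u v ∣u∣≥m ∣v∣≥m agree X≢Y
    Y-border : pref m v ≡ suff m v
    Y-border = SameLongerFactors.pref≡suff-if-pref≢ m v u ∣v∣≥m ∣u∣≥m (λ t ∣t∣≡1+m → sym (agree t ∣t∣≡1+m))
                                                     (λ Y≡X → X≢Y (sym Y≡X))

  occ-agree-below : ∀ n u v → n ≤ length u → n ≤ length v → OccAgree (suc n) u v → suff n u ≡ suff n v →
                    ∀ m → m ≤ n → OccAgree m u v
  occ-agree-below n u v ∣u∣≥n ∣v∣≥n agree suffₙ≡ m m≤n = downward (suc n ∸ m) m (m+[n∸m]≡n (m≤n⇒m≤1+n m≤n))
    where
    downward : ∀ j m → m + j ≡ suc n → OccAgree m u v
    downward zero m m+0≡1+n rewrite +-identityʳ m | m+0≡1+n = agree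
    downward (suc j) m m+1+j≡1+n = Equivalence.from
      (SameLongerFactors.occ-agree⇔suff≡ m u v (≤-trans m≤n′ ∣u∣≥n) (≤-trans m≤n′ ∣v∣≥n)
                                             (downward j (suc m) (trans (sym (+-suc m j)) m+1+j≡1+n)))
      (begin
        suff m u               ≡⟨ suff-suff m n u m≤n′ ∣u∣≥n ⟨
        suff m (suff n u)      ≡⟨ cong (suff m) suffₙ≡ ⟩
        suff m (suff n v)      ≡⟨ suff-suff m n v m≤n′ ∣v∣≥n ⟩
        suff m v               ∎)
      where
      open ≡-Reasoning
      m≤n′ : m ≤ n
      m≤n′ = subst (m ≤_) (suc-injective (trans (sym (+-suc m j)) m+1+j≡1+n)) (m≤m+n m j)

lemma3 : {A : Set} (_≟_ : DecidableEquality A) (k : ℕ) → 1 ≤ k →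
    (u v : List A) → k ∸ 1 ≤ length u → k ∸ 1 ≤ length v →
    ((t : List A) → length t ≡ k → Words.occ _≟_ t u ≡ Words.occ _≟_ t v) →
    let P1 = (s : List A) → s ≢ [] → length s ≤ k ∸ 1 → Words.occ _≟_ s u ≡ Words.occ _≟_ s v
        P2 = (s : List A) → length s ≡ k ∸ 1 → Words.occ _≟_ s u ≡ Words.occ _≟_ s v
        P4 = Words.pref _≟_ (k ∸ 1) u ≡ Words.pref _≟_ (k ∸ 1) v
        P5 = Words.suff _≟_ (k ∸ 1) u ≡ Words.suff _≟_ (k ∸ 1) v
        P3 = P4 × P5
        P6 = Σ ℕ (λ i → i ≤ k ∸ 1 × (Words.pref _≟_ i u ≡ Words.pref _≟_ i v × Words.suff _≟_ (k ∸ 1 ∸ i) u ≡ Words.suff _≟_ (k ∸ 1 ∸ i) v))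
    in (P1 ⇔ P2) × (P1 ⇔ P3) × (P1 ⇔ P4) × (P1 ⇔ P5) × (P1 ⇔ P6)
lemma3 _≟_ (suc n) _ u v ∣u∣≥n ∣v∣≥n agree =
    mk⇔ 1⇒2 2⇒1
  , mk⇔ (λ p1 → 2⇒4 (1⇒2 p1) , 2⇒5 (1⇒2 p1)) (λ p3 → 2⇒1 (4⇒2 (proj₁ p3)))
  , mk⇔ (λ p1 → 2⇒4 (1⇒2 p1)) (λ p4 → 2⇒1 (4⇒2 p4))
  , mk⇔ (λ p1 → 2⇒5 (1⇒2 p1)) (λ p5 → 2⇒1 (5⇒2 p5))
  , mk⇔ (λ p1 → n , ≤-refl , 2⇒4 (1⇒2 p1) , suff₀≡) (λ (i , i≤n , prefᵢ≡ , suffₙ₋ᵢ≡) →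
      2⇒1 (4⇒2 (pref≡-from-split _≟_ n u v ∣u∣≥n ∣v∣≥n agree i i≤n prefᵢ≡ suffₙ₋ᵢ≡)))
  where
  open Words _≟_
  open SameLongerFactors _≟_ n u v ∣u∣≥n ∣v∣≥n agree
  2⇒4 : OccAgree _≟_ n u v → pref n u ≡ pref n v
  2⇒4 = Equivalence.to occ-agree⇔pref≡
  4⇒2 : pref n u ≡ pref n v → OccAgree _≟_ n u v
  4⇒2 = Equivalence.from occ-agree⇔pref≡
  2⇒5 : OccAgree _≟_ n u v → suff n u ≡ suff n v
  2⇒5 = Equivalence.to occ-agree⇔suff≡
  5⇒2 : suff n u ≡ suff n v → OccAgree _≟_ n u v
  5⇒2 = Equivalence.from occ-agree⇔suff≡

  1⇒2 : ((s : List _) → s ≢ [] → length s ≤ n → occ s u ≡ occ s v) → OccAgree _≟_ n u v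
  -- (1) says nothing about the empty word, which only matters when n = 0, where pref₀ agree trivially
  1⇒2 p1 [] ∣s∣≡n = 4⇒2 (subst (λ j → pref j u ≡ pref j v) ∣s∣≡n refl) [] ∣s∣≡n
  1⇒2 p1 (c ∷ s) ∣s∣≡n = p1 (c ∷ s) (λ ()) (≤-reflexive ∣s∣≡n)

  2⇒1 : OccAgree _≟_ n u v → (s : List _) → s ≢ [] → length s ≤ n → occ s u ≡ occ s v
  2⇒1 p2 s _ ∣s∣≤n = occ-agree-below _≟_ n u v ∣u∣≥n ∣v∣≥n agree (2⇒5 p2) (length s) ∣s∣≤n s refl

  suff₀≡ : suff (n ∸ n) u ≡ suff (n ∸ n) v
  suff₀≡ rewrite n∸n≡0 n = trans (drop-all (length u) u ≤-refl) (sym (drop-all (length v) v ≤-refl))
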